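{- Let $X$ be a finite $2$-dimensional polyhedral complex with vertex set $F_0$, edge set $F_1$ and set of $2$-faces $F_2$. Suppose that (1) $\overline{A}_1 \ge 2$ and (2) $\overline{R}_1>0$. Then $\chi(X)>0$.
   Context: A $2$-dimensional polyhedral complex consists of vertices, edges (each incident to two vertices) and $2$-faces (polygons whose sides are edges of the complex). Write $x<y$ if the cell $x$ lies on the boundary of the cell $y$. The Euler characteristic is $\chi(X)=\#F_0-\#F_1+\#F_2$. For a vertex $v$, $A_0(v)=\#\{e\in F_1: v<e\}$. For an edge $e$: $A_1(e)=\#\{f\in F_2: e<f\}$; $B_1(e)=\#\{v\in F_0: v<e\}$ ($=2$); $U_1(e)=\sum_{f\in F_2,\, f>e} B_2(f)$ where $B_2(f)=\#\{e'\in F_1: e'<f\}$ is the number of edges of $f$; $D_1(e)=\sum_{v\in F_0,\, v<e} A_0(v)$. Define $R_1(e)=1+6A_1(e)+\tfrac32 B_1(e)-U_1(e)-D_1(e)$. The means are $\overline{A}_1=\frac{1}{\#F_1}\sum_{e\in F_1}A_1(e)$ and $\overline{R}_1=\frac{1}{\#F_1}\sum_{e\in F_1}R_1(e)$. -}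

module Defs where

import Level

open import Data.Nat as ℕ using (ℕ; zero; suc; _≤_; NonZero)
open import Data.Nat.DivMod using (_mod_)
open import Data.Fin using (Fin; toℕ)
open import Data.Fin.Properties using (_≟_)
open import Data.Integer as ℤ using (ℤ; +_)
open import Data.Rational as ℚ using (ℚ)
open import Data.Product using (Σ; ∃; _,_; _×_)
open import Data.Sum using (_⊎_)
open import Relation.Nullary using (Dec; does; ¬_)
open import Relation.Nullary.Decidable using (_⊎-dec_)
open import Relation.Unary using (Pred; Decidable)
open import Relation.Binary.PropositionalEquality using (_≡_; _≢_)
open import Function.Definitions using (Injective)
open import Data.Bool using (if_then_else_)
open import Data.Fin.Properties using (any?)

ℕ→ℚ : ℕ → ℚ
ℕ→ℚ n = + n ℚ./ 1

∑ℕ : ∀ {n} → (Fin n → ℕ) → ℕ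
∑ℕ {zero}  f = 0
∑ℕ {suc n} f = f Fin.zero ℕ.+ ∑ℕ (λ i → f (Fin.suc i))

∑ℚ : ∀ {n} → (Fin n → ℚ) → ℚ
∑ℚ {zero}  f = ℚ.0ℚ
∑ℚ {suc n} f = f Fin.zero ℚ.+ ∑ℚ (λ i → f (Fin.suc i))

count : ∀ {n} {P : Pred (Fin n) Level.zero} → Decidable P → ℕ
count P? = ∑ℕ (λ i → if does (P? i) then 1 else 0)

∑ℕ[_]_ : ∀ {n} {P : Pred (Fin n) Level.zero} → Decidable P → (Fin n → ℕ) → ℕ
∑ℕ[ P? ] f = ∑ℕ (λ i → if does (P? i) then f i else 0)

next : ∀ {k} .{{_ : NonZero k}} → Fin k → Fin k
next {k} i = suc (toℕ i) mod k

-- A polygonal 2-cell whose boundary is a simple closed edge path of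
-- k ≥ 3 sides: vertices vert 0, …, vert (k-1) (pairwise distinct) and
-- sides side 0, …, side (k-1) (pairwise distinct), side i joining
-- vert i and vert (i+1 mod k).
record Polygon (n₀ n₁ : ℕ) (src tgt : Fin n₁ → Fin n₀) : Set where
  field
    m        : ℕ
    vert     : Fin (3 ℕ.+ m) → Fin n₀
    side     : Fin (3 ℕ.+ m) → Fin n₁
    vert-inj : Injective _≡_ _≡_ vert
    side-inj : Injective _≡_ _≡_ side
    side-ends : ∀ i →
      (src (side i) ≡ vert i × tgt (side i) ≡ vert (next i)) ⊎
      (src (side i) ≡ vert (next i) × tgt (side i) ≡ vert i)

-- A finite 2-dimensional polyhedral complex: F₀ = Fin n₀, F₁ = Fin n₁,
-- F₂ = Fin n₂.  Each edge has two distinct end vertices; each 2-face is a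
-- polygon whose sides are edges of the complex.
record Complex : Set where
  field
    n₀ n₁ n₂ : ℕ
    src tgt  : Fin n₁ → Fin n₀
    src≢tgt  : ∀ e → src e ≢ tgt e
    face     : Fin n₂ → Polygon n₀ n₁ src tgt

  _<₀₁_ : Fin n₀ → Fin n₁ → Set
  v <₀₁ e = v ≡ src e ⊎ v ≡ tgt e

  _<₀₁?_ : ∀ v e → Dec (v <₀₁ e)
  v <₀₁? e = (v ≟ src e) ⊎-dec (v ≟ tgt e)

  _<₁₂_ : Fin n₁ → Fin n₂ → Set
  e <₁₂ f = ∃ λ i → Polygon.side (face f) i ≡ e

  _<₁₂?_ : ∀ e f → Dec (e <₁₂ f)
  e <₁₂? f = any? (λ i → Polygon.side (face f) i ≟ e)

  χ : ℤ
  χ = (+ n₀ ℤ.- + n₁) ℤ.+ + n₂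

  A₀ : Fin n₀ → ℕ
  A₀ v = count (v <₀₁?_)

  A₁ : Fin n₁ → ℕ
  A₁ e = count (e <₁₂?_)

  B₁ : Fin n₁ → ℕ
  B₁ e = count (_<₀₁? e)

  B₂ : Fin n₂ → ℕ
  B₂ f = count (_<₁₂? f)

  U₁ : Fin n₁ → ℕ
  U₁ e = ∑ℕ[ e <₁₂?_ ] B₂

  D₁ : Fin n₁ → ℕ
  D₁ e = ∑ℕ[ _<₀₁? e ] A₀

  R₁ : Fin n₁ → ℚ
  R₁ e = ((ℚ.1ℚ ℚ.+ ℕ→ℚ (6 ℕ.* A₁ e) ℚ.+ ((+ 3 ℚ./ 2) ℚ.* ℕ→ℚ (B₁ e)))
          ℚ.- ℕ→ℚ (U₁ e)) ℚ.- ℕ→ℚ (D₁ e)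

  meanA₁ : .{{NonZero n₁}} → ℚ
  meanA₁ = ℕ→ℚ (∑ℕ A₁) ℚ.* (+ 1 ℚ./ n₁)

  meanR₁ : .{{NonZero n₁}} → ℚ
  meanR₁ = ∑ℚ R₁ ℚ.* (+ 1 ℚ./ n₁)

-- Summing R₁ over the edges and double counting incidences gives
-- ∑ A₁ = ∑ B₂, ∑ U₁ = ∑ B₂², ∑ D₁ = ∑ A₀² and ∑ A₀ = ∑ B₁ = 2 #F₁.
-- Since k² ≥ 7k − 12 for every natural k, this yields
-- 12 χ ≥ ∑ R₁ + (∑ A₁ − 2 #F₁) = #F₁ (R̄₁ + Ā₁ − 2), which is positive
-- under the hypotheses.  The rational hypotheses are transported to
-- integers through ℚᵘ, whose order is cross-multiplication.
module Submission where

open import Defs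
open import Data.Bool using (Bool; true; false; if_then_else_)
open import Data.Fin using (Fin; zero; suc)
open import Data.Fin.Properties using (_≟_)
open import Data.Nat using (ℕ; zero; suc; NonZero; _+_; _*_; _≤_; _<_; z≤n)
open import Data.Nat.Properties hiding (_≟_)
open import Data.Nat.Tactic.RingSolver using (solve-∀)
open import Data.Integer as ℤ using (+_; 0ℤ; _⊖_)
import Data.Integer.Properties as ℤₚ
import Data.Integer.Tactic.RingSolver as ℤ-Solver
open import Data.Rational as ℚ using (ℚ; 0ℚ; 1ℚ; toℚᵘ)
import Data.Rational.Properties as ℚₚ
open import Data.Rational.Unnormalised as ℚᵘ using (_≃_; *≡*; *≤*; *<*)
  renaming (_/_ to _/ᵘ_)
import Data.Rational.Unnormalised.Properties as ℚᵘₚ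
open import Data.Product using (_×_; _,_)
open import Function using (flip)
open import Relation.Binary.PropositionalEquality
open import Relation.Nullary using (Dec; does; yes; no; ¬_; contradiction)
open import Relation.Nullary.Decidable using (_⊎-dec_)
open import Relation.Unary using (Pred; Decidable)
open import Algebra.Properties.Semiring.Sum +-*-semiring
  using (sum; ∑-distrib-+; ∑-comm; *-distribˡ-sum; sum-cong-≗)

private
  variable
    m n : ℕ

∑ℕ≡sum : (f : Fin n → ℕ) → ∑ℕ f ≡ sum f
∑ℕ≡sum {zero}  f = refl
∑ℕ≡sum {suc n} f = cong (_+_ (f zero)) (∑ℕ≡sum (λ i → f (suc i)))

∑ℕ-cong : {f g : Fin n → ℕ} → f ≗ g → ∑ℕ f ≡ ∑ℕ g
∑ℕ-cong {zero}  f≗g = refl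
∑ℕ-cong {suc n} f≗g = cong₂ _+_ (f≗g zero) (∑ℕ-cong (λ i → f≗g (suc i)))

∑ℕ-mono-≤ : {f g : Fin n → ℕ} → (∀ i → f i ≤ g i) → ∑ℕ f ≤ ∑ℕ g
∑ℕ-mono-≤ {zero}  f≤g = z≤n
∑ℕ-mono-≤ {suc n} f≤g = +-mono-≤ (f≤g zero) (∑ℕ-mono-≤ (λ i → f≤g (suc i)))

∑ℕ-const : ∀ c → ∑ℕ {n} (λ _ → c) ≡ n * c
∑ℕ-const {zero}  c = refl
∑ℕ-const {suc n} c = cong (_+_ c) (∑ℕ-const {n} c)

∑ℕ-distrib-+ : (f g : Fin n → ℕ) → ∑ℕ (λ i → f i + g i) ≡ ∑ℕ f + ∑ℕ g
∑ℕ-distrib-+ f g = begin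
  ∑ℕ (λ i → f i + g i)  ≡⟨ ∑ℕ≡sum (λ i → f i + g i) ⟩
  sum (λ i → f i + g i) ≡⟨ ∑-distrib-+ f g ⟩
  sum f + sum g         ≡⟨ cong₂ _+_ (∑ℕ≡sum f) (∑ℕ≡sum g) ⟨
  ∑ℕ f + ∑ℕ g           ∎
  where open ≡-Reasoning

∑ℕ-*ˡ : ∀ c (f : Fin n → ℕ) → ∑ℕ (λ i → c * f i) ≡ c * ∑ℕ f
∑ℕ-*ˡ c f = begin
  ∑ℕ (λ i → c * f i)  ≡⟨ ∑ℕ≡sum (λ i → c * f i) ⟩
  sum (λ i → c * f i) ≡⟨ *-distribˡ-sum c f ⟨
  c * sum f           ≡⟨ cong (c *_) (∑ℕ≡sum f) ⟨
  c * ∑ℕ f            ∎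
  where open ≡-Reasoning

∑ℕ-comm : (f : Fin m → Fin n → ℕ) →
          ∑ℕ (λ i → ∑ℕ (f i)) ≡ ∑ℕ (λ j → ∑ℕ (λ i → f i j))
∑ℕ-comm f = begin
  ∑ℕ (λ i → ∑ℕ (f i))           ≡⟨ ∑ℕ²≡sum² f ⟩
  sum (λ i → sum (f i))         ≡⟨ ∑-comm f ⟩
  sum (λ j → sum (λ i → f i j)) ≡⟨ ∑ℕ²≡sum² (flip f) ⟨
  ∑ℕ (λ j → ∑ℕ (λ i → f i j))   ∎
  where
  open ≡-Reasoning
  ∑ℕ²≡sum² : ∀ {m n} (g : Fin m → Fin n → ℕ) →
             ∑ℕ (λ i → ∑ℕ (g i)) ≡ sum (λ i → sum (g i))
  ∑ℕ²≡sum² g = trans (∑ℕ≡sum (λ i → ∑ℕ (g i))) (sum-cong-≗ (λ i → ∑ℕ≡sum (g i)))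

square-sum-bound : (f : Fin n → ℕ) →
                   7 * ∑ℕ f ≤ ∑ℕ (λ i → f i * f i) + n * 12
square-sum-bound {n} f = begin
  7 * ∑ℕ f                        ≡⟨ ∑ℕ-*ˡ 7 f ⟨
  ∑ℕ (λ i → 7 * f i)              ≤⟨ ∑ℕ-mono-≤ (λ i → square-bound (f i)) ⟩
  ∑ℕ (λ i → f i * f i + 12)       ≡⟨ ∑ℕ-distrib-+ {n} (λ i → f i * f i) (λ _ → 12) ⟩
  ∑ℕ (λ i → f i * f i) + ∑ℕ {n} (λ _ → 12)
                                  ≡⟨ cong (_+_ (∑ℕ (λ i → f i * f i))) (∑ℕ-const {n} 12) ⟩
  ∑ℕ (λ i → f i * f i) + n * 12   ∎
  where
  open ≤-Reasoning
  -- (k − 3)(k − 4) ≥ 0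
  square-bound : ∀ k → 7 * k ≤ k * k + 12
  square-bound 0 = z≤n
  square-bound 1 = m≤m+n 7 6
  square-bound 2 = m≤m+n 14 2
  square-bound 3 = ≤-refl
  square-bound (suc (suc (suc (suc j)))) =
    subst (7 * (4 + j) ≤_) (expand j) (m≤m+n (7 * (4 + j)) (j + j * j))
    where
    expand : ∀ j → 7 * (4 + j) + (j + j * j) ≡ (4 + j) * (4 + j) + 12
    expand = solve-∀

indicator : Bool → ℕ → ℕ
indicator b c = if b then c else 0

indicator≡*1 : ∀ b c → indicator b c ≡ c * indicator b 1
indicator≡*1 true  c = sym (*-identityʳ c)
indicator≡*1 false c = sym (*-zeroʳ c)

count-≡ : (a : Fin n) → count (_≟ a) ≡ 1
count-≡ {suc n} zero    = cong suc (trans (∑ℕ-const {n} 0) (*-zeroʳ n))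
count-≡ {suc n} (suc a) = count-≡ a

count-⊎ : {P Q : Pred (Fin n) _} (P? : Decidable P) (Q? : Decidable Q) →
          (∀ i → ¬ (P i × Q i)) →
          count (λ i → P? i ⊎-dec Q? i) ≡ count P? + count Q?
count-⊎ P? Q? disjoint = trans (∑ℕ-cong pointwise)
  (∑ℕ-distrib-+ (λ i → indicator (does (P? i)) 1) (λ i → indicator (does (Q? i)) 1))
  where
  pointwise : ∀ i → indicator (does (P? i ⊎-dec Q? i)) 1
                    ≡ indicator (does (P? i)) 1 + indicator (does (Q? i)) 1
  pointwise i with P? i | Q? i
  ... | yes p | yes q = contradiction (p , q) (disjoint i)
  ... | yes _ | no  _ = refl
  ... | no  _ | yes _ = refl
  ... | no  _ | no  _ = refl

module _ {R : Fin m → Fin n → Set} (R? : ∀ i j → Dec (R i j)) where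

  count-double : ∑ℕ (λ i → count (R? i)) ≡ ∑ℕ (λ j → count (λ i → R? i j))
  count-double = ∑ℕ-comm (λ i j → indicator (does (R? i j)) 1)

  weighted-count-double : (g : Fin n → ℕ) →
    ∑ℕ (λ i → ∑ℕ[ R? i ] g) ≡ ∑ℕ (λ j → g j * count (λ i → R? i j))
  weighted-count-double g = trans (∑ℕ-comm (λ i j → indicator (does (R? i j)) (g j)))
    (∑ℕ-cong λ j → trans (∑ℕ-cong (λ i → indicator≡*1 (does (R? i j)) (g j)))
                         (∑ℕ-*ˡ (g j) (λ i → indicator (does (R? i j)) 1)))

⊖-+-⊖ : ∀ a b c d → (a ⊖ b) ℤ.+ (c ⊖ d) ≡ (a + c) ⊖ (b + d)
⊖-+-⊖ a b c d = begin
  (a ⊖ b) ℤ.+ (c ⊖ d)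
    ≡⟨ cong₂ ℤ._+_ (ℤₚ.[+m]-[+n]≡m⊖n a b) (ℤₚ.[+m]-[+n]≡m⊖n c d) ⟨
  (+ a ℤ.- + b) ℤ.+ (+ c ℤ.- + d)  ≡⟨ regroup (+ a) (+ b) (+ c) (+ d) ⟩
  (+ a ℤ.+ + c) ℤ.- (+ b ℤ.+ + d)  ≡⟨ cong₂ ℤ._-_ (ℤₚ.pos-+ a c) (ℤₚ.pos-+ b d) ⟨
  + (a + c) ℤ.- + (b + d)          ≡⟨ ℤₚ.[+m]-[+n]≡m⊖n (a + c) (b + d) ⟩
  (a + c) ⊖ (b + d)                ∎
  where
  open ≡-Reasoning
  regroup : ∀ w x y z → (w ℤ.- x) ℤ.+ (y ℤ.- z) ≡ (w ℤ.+ y) ℤ.- (x ℤ.+ z)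
  regroup = ℤ-Solver.solve-∀

0<m⊖n⇒n<m : ∀ {m n} → 0ℤ ℤ.< m ⊖ n → n < m
0<m⊖n⇒n<m {m} {n} 0<m⊖n with n <? m
... | yes n<m = n<m
... | no  n≮m = contradiction 0<m⊖n (ℤₚ.≤⇒≯ m⊖n≤0)
  where
  m⊖n≤0 : m ⊖ n ℤ.≤ 0ℤ
  m⊖n≤0 = subst (m ⊖ n ℤ.≤_) (ℤₚ.n⊖n≡0 n) (ℤₚ.⊖-monoˡ-≤ n (≮⇒≥ n≮m))

n<m⇒0<m⊖n : ∀ {m n} → n < m → 0ℤ ℤ.< m ⊖ n
n<m⇒0<m⊖n n<m = subst (0ℤ ℤ.<_) (sym (ℤₚ.⊖-≥ (<⇒≤ n<m))) (ℤ.+<+ (m<n⇒0<n∸m n<m))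

toℚᵘ-/ : ∀ i n .{{_ : NonZero n}} → toℚᵘ (i ℚ./ n) ≃ i /ᵘ n
toℚᵘ-/ i (suc n) = ℚₚ.toℚᵘ-fromℚᵘ (i /ᵘ suc n)

toℚᵘ-homo-- : ∀ p q → toℚᵘ (p ℚ.- q) ≃ toℚᵘ p ℚᵘ.- toℚᵘ q
toℚᵘ-homo-- p q = ℚᵘₚ.≃-trans (ℚₚ.toℚᵘ-homo-+ p (ℚ.- q))
                              (ℚᵘₚ.+-congʳ (toℚᵘ p) (ℚₚ.toℚᵘ-homo‿- q))

R-formᵘ≃numerator/2 : ∀ x y u d →
  ((+ 1 /ᵘ 1 ℚᵘ.+ x /ᵘ 1 ℚᵘ.+ (+ 3 /ᵘ 2) ℚᵘ.* (y /ᵘ 1)) ℚᵘ.- u /ᵘ 1) ℚᵘ.- d /ᵘ 1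
  ≃ ((+ 2 ℤ.+ + 2 ℤ.* x ℤ.+ + 3 ℤ.* y) ℤ.- (+ 2 ℤ.* u ℤ.+ + 2 ℤ.* d)) /ᵘ 2
R-formᵘ≃numerator/2 x y u d = *≡* (cross x y u d)
  where
  -- the ≃ unfolded by cross-multiplication
  cross : ∀ x y u d →
    ((((+ 1 ℤ.* + 1 ℤ.+ x ℤ.* + 1) ℤ.* + 2 ℤ.+ (+ 3 ℤ.* y) ℤ.* + 1) ℤ.* + 1
      ℤ.+ (ℤ.- u) ℤ.* + 2) ℤ.* + 1 ℤ.+ (ℤ.- d) ℤ.* + 2) ℤ.* + 2
    ≡ ((+ 2 ℤ.+ + 2 ℤ.* x ℤ.+ + 3 ℤ.* y) ℤ.- (+ 2 ℤ.* u ℤ.+ + 2 ℤ.* d)) ℤ.* + 2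
  cross = ℤ-Solver.solve-∀

toℚᵘ-R-form : ∀ a b u d →
  toℚᵘ (((1ℚ ℚ.+ ℕ→ℚ a ℚ.+ (+ 3 ℚ./ 2) ℚ.* ℕ→ℚ b) ℚ.- ℕ→ℚ u) ℚ.- ℕ→ℚ d)
  ≃ ((2 + 2 * a + 3 * b) ⊖ (2 * u + 2 * d)) /ᵘ 2
toℚᵘ-R-form a b u d = begin
  toℚᵘ ((pos ℚ.- ℕ→ℚ u) ℚ.- ℕ→ℚ d)
    ≈⟨ toℚᵘ-homo-- (pos ℚ.- ℕ→ℚ u) (ℕ→ℚ d) ⟩
  toℚᵘ (pos ℚ.- ℕ→ℚ u) ℚᵘ.- toℚᵘ (ℕ→ℚ d)
    ≈⟨ ℚᵘₚ.+-cong (ℚᵘₚ.≃-trans (toℚᵘ-homo-- pos (ℕ→ℚ u))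
                               (ℚᵘₚ.+-cong pos≃ (ℚᵘₚ.-‿cong (toℚᵘ-/ (+ u) 1))))
                  (ℚᵘₚ.-‿cong (toℚᵘ-/ (+ d) 1)) ⟩
  ((+ 1 /ᵘ 1 ℚᵘ.+ + a /ᵘ 1 ℚᵘ.+ (+ 3 /ᵘ 2) ℚᵘ.* (+ b /ᵘ 1)) ℚᵘ.- + u /ᵘ 1) ℚᵘ.- + d /ᵘ 1
    ≈⟨ R-formᵘ≃numerator/2 (+ a) (+ b) (+ u) (+ d) ⟩
  ((+ 2 ℤ.+ + 2 ℤ.* + a ℤ.+ + 3 ℤ.* + b) ℤ.- (+ 2 ℤ.* + u ℤ.+ + 2 ℤ.* + d)) /ᵘ 2
    ≡⟨ cong (_/ᵘ 2) (trans (cong₂ ℤ._-_ (sym numerator⁺) (sym numerator⁻))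
                           (ℤₚ.[+m]-[+n]≡m⊖n (2 + 2 * a + 3 * b) (2 * u + 2 * d))) ⟩
  ((2 + 2 * a + 3 * b) ⊖ (2 * u + 2 * d)) /ᵘ 2 ∎
  where
  open ℚᵘₚ.≃-Reasoning
  pos = 1ℚ ℚ.+ ℕ→ℚ a ℚ.+ (+ 3 ℚ./ 2) ℚ.* ℕ→ℚ b
  pos≃ : toℚᵘ pos ≃ + 1 /ᵘ 1 ℚᵘ.+ + a /ᵘ 1 ℚᵘ.+ (+ 3 /ᵘ 2) ℚᵘ.* (+ b /ᵘ 1)
  pos≃ = ℚᵘₚ.≃-trans (ℚₚ.toℚᵘ-homo-+ (1ℚ ℚ.+ ℕ→ℚ a) _)
           (ℚᵘₚ.+-cong (ℚᵘₚ.≃-trans (ℚₚ.toℚᵘ-homo-+ 1ℚ (ℕ→ℚ a))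
                                    (ℚᵘₚ.+-cong (toℚᵘ-/ (+ 1) 1) (toℚᵘ-/ (+ a) 1)))
                       (ℚᵘₚ.≃-trans (ℚₚ.toℚᵘ-homo-* (+ 3 ℚ./ 2) (ℕ→ℚ b))
                                    (ℚᵘₚ.*-cong (toℚᵘ-/ (+ 3) 2) (toℚᵘ-/ (+ b) 1))))
  numerator⁺ : + (2 + 2 * a + 3 * b) ≡ + 2 ℤ.+ + 2 ℤ.* + a ℤ.+ + 3 ℤ.* + b
  numerator⁺ = trans (ℤₚ.pos-+ (2 + 2 * a) (3 * b))
                     (cong₂ ℤ._+_ (trans (ℤₚ.pos-+ 2 (2 * a)) (cong (ℤ._+_ (+ 2)) (ℤₚ.pos-* 2 a)))
                                  (ℤₚ.pos-* 3 b))
  numerator⁻ : + (2 * u + 2 * d) ≡ + 2 ℤ.* + u ℤ.+ + 2 ℤ.* + d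
  numerator⁻ = trans (ℤₚ.pos-+ (2 * u) (2 * d)) (cong₂ ℤ._+_ (ℤₚ.pos-* 2 u) (ℤₚ.pos-* 2 d))

toℚᵘ-∑ℚ : (f : Fin n → ℚ) (p q : Fin n → ℕ) →
          (∀ i → toℚᵘ (f i) ≃ (p i ⊖ q i) /ᵘ 2) →
          toℚᵘ (∑ℚ f) ≃ (∑ℕ p ⊖ ∑ℕ q) /ᵘ 2
toℚᵘ-∑ℚ {zero}  f p q f≃ = *≡* refl
toℚᵘ-∑ℚ {suc n} f p q f≃ = begin
  toℚᵘ (f zero ℚ.+ ∑ℚ (λ i → f (suc i)))
    ≈⟨ ℚₚ.toℚᵘ-homo-+ (f zero) _ ⟩
  toℚᵘ (f zero) ℚᵘ.+ toℚᵘ (∑ℚ (λ i → f (suc i)))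
    ≈⟨ ℚᵘₚ.+-cong (f≃ zero) (toℚᵘ-∑ℚ _ _ _ (λ i → f≃ (suc i))) ⟩
  (p zero ⊖ q zero) /ᵘ 2 ℚᵘ.+ (∑ℕ p′ ⊖ ∑ℕ q′) /ᵘ 2
    ≈⟨ halves-+ (p zero ⊖ q zero) (∑ℕ p′ ⊖ ∑ℕ q′) ⟩
  ((p zero ⊖ q zero) ℤ.+ (∑ℕ p′ ⊖ ∑ℕ q′)) /ᵘ 2
    ≡⟨ cong (_/ᵘ 2) (⊖-+-⊖ (p zero) (q zero) (∑ℕ p′) (∑ℕ q′)) ⟩
  (∑ℕ p ⊖ ∑ℕ q) /ᵘ 2 ∎
  where
  open ℚᵘₚ.≃-Reasoning
  p′ = λ i → p (suc i)
  q′ = λ i → q (suc i)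
  halves-+ : ∀ x y → x /ᵘ 2 ℚᵘ.+ y /ᵘ 2 ≃ (x ℤ.+ y) /ᵘ 2
  halves-+ x y = *≡* (cross x y)
    where
    cross : ∀ x y → (x ℤ.* + 2 ℤ.+ y ℤ.* + 2) ℤ.* + 2 ≡ (x ℤ.+ y) ℤ.* + 4
    cross = ℤ-Solver.solve-∀

toℚᵘ-mean : ∀ q x n .{{_ : NonZero n}} →
            toℚᵘ q ≃ x → toℚᵘ (q ℚ.* (+ 1 ℚ./ n)) ≃ x ℚᵘ.* (+ 1 /ᵘ n)
toℚᵘ-mean q x n q≃x = ℚᵘₚ.≃-trans (ℚₚ.toℚᵘ-homo-* q _) (ℚᵘₚ.*-cong q≃x (toℚᵘ-/ (+ 1) n))

0<[i/m]/n⇒0<i : ∀ i m n .{{_ : NonZero m}} .{{_ : NonZero n}} →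
                ℚᵘ.0ℚᵘ ℚᵘ.< (i /ᵘ m) ℚᵘ.* (+ 1 /ᵘ n) → 0ℤ ℤ.< i
0<[i/m]/n⇒0<i i (suc m) (suc n) (*<* 0<i*1*1) =
  subst (0ℤ ℤ.<_) (trans (ℤₚ.*-identityʳ _) (ℤₚ.*-identityʳ i)) 0<i*1*1

a≤b/n⇒a*n≤b : ∀ a b n .{{_ : NonZero n}} →
              + a /ᵘ 1 ℚᵘ.≤ (+ b /ᵘ 1) ℚᵘ.* (+ 1 /ᵘ n) → a * n ≤ b
a≤b/n⇒a*n≤b a b (suc n) (*≤* cross) = ℤₚ.drop‿+≤+
  (subst₂ ℤ._≤_ (trans (cong (λ k → + a ℤ.* + k) (*-identityˡ (suc n))) (sym (ℤₚ.pos-* a (suc n))))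
                (trans (ℤₚ.*-identityʳ _) (ℤₚ.*-identityʳ (+ b))) cross)

module _ (X : Complex) where
  open Complex X

  B₁≡2 : ∀ e → B₁ e ≡ 2
  B₁≡2 e = trans (count-⊎ (_≟ src e) (_≟ tgt e) distinct)
                 (cong₂ _+_ (count-≡ (src e)) (count-≡ (tgt e)))
    where
    distinct : ∀ v → ¬ (v ≡ src e × v ≡ tgt e)
    distinct v (refl , v≡tgt) = src≢tgt e v≡tgt

  ∑A₀≡2n₁ : ∑ℕ A₀ ≡ n₁ * 2
  ∑A₀≡2n₁ = begin
    ∑ℕ A₀  ≡⟨ count-double (λ e v → v <₀₁? e) ⟨
    ∑ℕ B₁  ≡⟨ ∑ℕ-cong B₁≡2 ⟩
    ∑ℕ {n₁} (λ _ → 2) ≡⟨ ∑ℕ-const {n₁} 2 ⟩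
    n₁ * 2 ∎
    where open ≡-Reasoning

  R₁⁺ R₁⁻ : Fin n₁ → ℕ
  R₁⁺ e = 2 + 2 * (6 * A₁ e) + 3 * B₁ e
  R₁⁻ e = 2 * U₁ e + 2 * D₁ e

  toℚᵘ-R₁ : ∀ e → toℚᵘ (R₁ e) ≃ (R₁⁺ e ⊖ R₁⁻ e) /ᵘ 2
  toℚᵘ-R₁ e = toℚᵘ-R-form (6 * A₁ e) (B₁ e) (U₁ e) (D₁ e)

  ∑R₁⁺≡ : ∑ℕ R₁⁺ ≡ n₁ * 2 + 2 * (6 * ∑ℕ A₁) + 3 * (n₁ * 2)
  ∑R₁⁺≡ = begin
    ∑ℕ R₁⁺
      ≡⟨ ∑ℕ-distrib-+ (λ e → 2 + 2 * (6 * A₁ e)) (λ e → 3 * B₁ e) ⟩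
    ∑ℕ (λ e → 2 + 2 * (6 * A₁ e)) + ∑ℕ (λ e → 3 * B₁ e)
      ≡⟨ cong₂ _+_ (∑ℕ-distrib-+ {n₁} (λ _ → 2) (λ e → 2 * (6 * A₁ e))) (∑ℕ-*ˡ 3 B₁) ⟩
    ∑ℕ {n₁} (λ _ → 2) + ∑ℕ (λ e → 2 * (6 * A₁ e)) + 3 * ∑ℕ B₁
      ≡⟨ cong₂ (λ s t → s + t + 3 * ∑ℕ B₁) (∑ℕ-const {n₁} 2)
               (trans (∑ℕ-*ˡ 2 (λ e → 6 * A₁ e)) (cong (2 *_) (∑ℕ-*ˡ 6 A₁))) ⟩
    n₁ * 2 + 2 * (6 * ∑ℕ A₁) + 3 * ∑ℕ B₁
      ≡⟨ cong (λ t → n₁ * 2 + 2 * (6 * ∑ℕ A₁) + 3 * t)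
              (trans (∑ℕ-cong B₁≡2) (∑ℕ-const {n₁} 2)) ⟩
    n₁ * 2 + 2 * (6 * ∑ℕ A₁) + 3 * (n₁ * 2) ∎
    where open ≡-Reasoning

  ∑R₁⁻≡ : ∑ℕ R₁⁻ ≡ 2 * ∑ℕ (λ f → B₂ f * B₂ f) + 2 * ∑ℕ (λ v → A₀ v * A₀ v)
  ∑R₁⁻≡ = trans (∑ℕ-distrib-+ (λ e → 2 * U₁ e) (λ e → 2 * D₁ e))
    (cong₂ _+_ (trans (∑ℕ-*ˡ 2 U₁) (cong (2 *_) (weighted-count-double _<₁₂?_ B₂)))
               (trans (∑ℕ-*ˡ 2 D₁) (cong (2 *_) (weighted-count-double (λ e v → v <₀₁? e) A₀))))

  -- That is, 2 ∑ R₁ + 2 (∑ A₁ − 2 n₁) ≤ 24 χ.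
  ∑R₁-bound : ∑ℕ R₁⁺ + 2 * ∑ℕ A₁ + 20 * n₁ ≤ ∑ℕ R₁⁻ + 24 * (n₀ + n₂)
  ∑R₁-bound = begin
    ∑ℕ R₁⁺ + 2 * S + 20 * n₁
      ≡⟨ cong (λ t → t + 2 * S + 20 * n₁) ∑R₁⁺≡ ⟩
    n₁ * 2 + 2 * (6 * S) + 3 * (n₁ * 2) + 2 * S + 20 * n₁
      ≡⟨ regroup S n₁ ⟩
    2 * (7 * S) + 2 * (7 * (n₁ * 2))
      ≡⟨ cong (λ t → 2 * (7 * S) + 2 * (7 * t)) ∑A₀≡2n₁ ⟨
    2 * (7 * S) + 2 * (7 * ∑ℕ A₀)
      ≤⟨ +-mono-≤ (*-monoʳ-≤ 2 (subst (λ t → 7 * t ≤ Q₂ + n₂ * 12) (sym ∑A₁≡∑B₂)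
                                       (square-sum-bound B₂)))
                  (*-monoʳ-≤ 2 (square-sum-bound A₀)) ⟩
    2 * (Q₂ + n₂ * 12) + 2 * (Q₀ + n₀ * 12)
      ≡⟨ collect Q₂ Q₀ n₀ n₂ ⟩
    2 * Q₂ + 2 * Q₀ + 24 * (n₀ + n₂)
      ≡⟨ cong (_+ 24 * (n₀ + n₂)) ∑R₁⁻≡ ⟨
    ∑ℕ R₁⁻ + 24 * (n₀ + n₂) ∎
    where
    open ≤-Reasoning
    S  = ∑ℕ A₁
    Q₂ = ∑ℕ (λ f → B₂ f * B₂ f)
    Q₀ = ∑ℕ (λ v → A₀ v * A₀ v)
    ∑A₁≡∑B₂ : ∑ℕ A₁ ≡ ∑ℕ B₂
    ∑A₁≡∑B₂ = count-double _<₁₂?_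
    regroup : ∀ S n → n * 2 + 2 * (6 * S) + 3 * (n * 2) + 2 * S + 20 * n
                      ≡ 2 * (7 * S) + 2 * (7 * (n * 2))
    regroup = solve-∀
    collect : ∀ a b m n → 2 * (a + n * 12) + 2 * (b + m * 12) ≡ 2 * a + 2 * b + 24 * (m + n)
    collect = solve-∀

  0<χ : ∑ℕ R₁⁻ < ∑ℕ R₁⁺ → 2 * n₁ ≤ ∑ℕ A₁ → 0ℤ ℤ.< χ
  0<χ ∑R₁>0 ∑A₁≥2n₁ =
    subst (0ℤ ℤ.<_) χ≡
      (n<m⇒0<m⊖n (*-cancelˡ-< 24 n₁ (n₀ + n₂) (+-cancelˡ-< (∑ℕ R₁⁻) _ _ chain)))
    where
    open ≤-Reasoning
    chain : ∑ℕ R₁⁻ + 24 * n₁ < ∑ℕ R₁⁻ + 24 * (n₀ + n₂)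
    chain = begin-strict
      ∑ℕ R₁⁻ + 24 * n₁              ≡⟨ cong (_+_ (∑ℕ R₁⁻)) (split n₁) ⟩
      ∑ℕ R₁⁻ + (2 * (2 * n₁) + 20 * n₁)
        <⟨ +-mono-<-≤ ∑R₁>0 (+-monoˡ-≤ (20 * n₁) (*-monoʳ-≤ 2 ∑A₁≥2n₁)) ⟩
      ∑ℕ R₁⁺ + (2 * ∑ℕ A₁ + 20 * n₁) ≡⟨ +-assoc (∑ℕ R₁⁺) _ _ ⟨
      ∑ℕ R₁⁺ + 2 * ∑ℕ A₁ + 20 * n₁  ≤⟨ ∑R₁-bound ⟩
      ∑ℕ R₁⁻ + 24 * (n₀ + n₂)       ∎
      where
      split : ∀ n → 24 * n ≡ 2 * (2 * n) + 20 * n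
      split = solve-∀
    χ≡ : (n₀ + n₂) ⊖ n₁ ≡ χ
    χ≡ = trans (sym (ℤₚ.distribˡ-⊖-+-pos n₂ n₀ n₁))
               (cong (ℤ._+ + n₂) (sym (ℤₚ.[+m]-[+n]≡m⊖n n₀ n₁)))

lemma2 : (X : Complex) → let open Complex X in
    ⦃ _ : NonZero n₁ ⦄ →
    ℕ→ℚ 2 ℚ.≤ meanA₁ →
    0ℚ ℚ.< meanR₁ →
    0ℤ ℤ.< χ
lemma2 X 2≤meanA₁ 0<meanR₁ = 0<χ X ∑R₁>0 ∑A₁≥2n₁
  where
  open Complex X
  ∑R₁>0 : ∑ℕ (R₁⁻ X) < ∑ℕ (R₁⁺ X)
  ∑R₁>0 = 0<m⊖n⇒n<m (0<[i/m]/n⇒0<i _ 2 n₁ (ℚᵘₚ.<-respʳ-≃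
    (toℚᵘ-mean (∑ℚ R₁) _ n₁ (toℚᵘ-∑ℚ R₁ (R₁⁺ X) (R₁⁻ X) (toℚᵘ-R₁ X)))
    (ℚₚ.toℚᵘ-mono-< 0<meanR₁)))
  ∑A₁≥2n₁ : 2 * n₁ ≤ ∑ℕ A₁
  ∑A₁≥2n₁ = a≤b/n⇒a*n≤b 2 (∑ℕ A₁) n₁
    (ℚᵘₚ.≤-respʳ-≃ (toℚᵘ-mean (ℕ→ℚ (∑ℕ A₁)) _ n₁ (toℚᵘ-/ _ 1))
                   (ℚᵘₚ.≤-respˡ-≃ (toℚᵘ-/ (+ 2) 1) (ℚₚ.toℚᵘ-mono-≤ 2≤meanA₁)))
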